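{- (Truth lemma) In the canonical model $\langle W, \mathcal{N}, \leq, V \rangle$, for every formula $\varphi$ and every $w \in W$: $w \Vdash \varphi$ if and only if $\varphi \in w$.
   Context: Formulas are built from a denumerable set $PV$ of propositional variables and $\bot$ using $\land, \lor, \rightarrow, \Box$. The logic $L$ is the smallest set of formulas containing all instances of the intuitionistic propositional axiom schemes (in this language) and of $\Box \varphi \rightarrow \varphi$, closed under modus ponens and the rule: from $\varphi \leftrightarrow \psi$ infer $\Box \varphi \leftrightarrow \Box \psi$. An $L$-theory is a set of formulas containing all theorems of $L$ and closed under modus ponens; it is prime if $\bot \notin w$ and $\varphi \lor \psi \in w$ iff $\varphi \in w$ or $\psi \in w$. The canonical model: $W$ is the set of all prime $L$-theories; $w \leq v$ iff $w \subseteq v$; $\mathcal{N}_w = \{\{z \in W : \varphi \in z\} : \Box \varphi \in w\}$; $V(q) = \{w \in W : q \in w\}$. Forcing: $w \nVdash \bot$; $w \Vdash q$ iff $w \in V(q)$; $\lor, \land$ pointwise; $w \Vdash \varphi \rightarrow \psi$ iff for every $v \geq w$, $v \nVdash \varphi$ or $v \Vdash \psi$; $w \Vdash \Box \varphi$ iff $w \Vdash \varphi$ and $\{z \in W : z \Vdash \varphi\} \in \mathcal{N}_w$. -}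

module Defs where

open import Level using (Level; 0ℓ; Lift) renaming (suc to lsuc)
open import Data.Nat using (ℕ)
open import Data.Empty using () renaming (⊥ to Empty)
open import Data.Product using (Σ; _×_; _,_)
open import Data.Sum using (_⊎_)
open import Relation.Nullary using (¬_)
open import Function.Bundles using (_⇔_)

infixr 6 _∧'_
infixr 5 _∨'_
infixr 4 _⇒_

data Formula : Set where
  var  : ℕ → Formula
  ⊥'   : Formula
  _∧'_ : Formula → Formula → Formula
  _∨'_ : Formula → Formula → Formula
  _⇒_  : Formula → Formula → Formula
  □    : Formula → Formula

_⇔'_ : Formula → Formula → Formula
φ ⇔' ψ = (φ ⇒ ψ) ∧' (ψ ⇒ φ)

data L⊢_ : Formula → Set where
  ax-K   : ∀ φ ψ → L⊢ (φ ⇒ ψ ⇒ φ)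
  ax-S   : ∀ φ ψ χ → L⊢ ((φ ⇒ ψ ⇒ χ) ⇒ (φ ⇒ ψ) ⇒ φ ⇒ χ)
  ax-∧E₁ : ∀ φ ψ → L⊢ (φ ∧' ψ ⇒ φ)
  ax-∧E₂ : ∀ φ ψ → L⊢ (φ ∧' ψ ⇒ ψ)
  ax-∧I  : ∀ φ ψ → L⊢ (φ ⇒ ψ ⇒ φ ∧' ψ)
  ax-∨I₁ : ∀ φ ψ → L⊢ (φ ⇒ φ ∨' ψ)
  ax-∨I₂ : ∀ φ ψ → L⊢ (ψ ⇒ φ ∨' ψ)
  ax-∨E  : ∀ φ ψ χ → L⊢ ((φ ⇒ χ) ⇒ (ψ ⇒ χ) ⇒ φ ∨' ψ ⇒ χ)
  ax-⊥E  : ∀ φ → L⊢ (⊥' ⇒ φ)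
  ax-T   : ∀ φ → L⊢ (□ φ ⇒ φ)
  mp     : ∀ {φ ψ} → L⊢ (φ ⇒ ψ) → L⊢ φ → L⊢ ψ
  rule-E : ∀ {φ ψ} → L⊢ (φ ⇔' ψ) → L⊢ (□ φ ⇔' □ ψ)

FormulaSet : Set₁
FormulaSet = Formula → Set

record IsLTheory (Γ : FormulaSet) : Set where
  field
    theorems : ∀ {φ} → L⊢ φ → Γ φ
    mp-closed : ∀ {φ ψ} → Γ (φ ⇒ ψ) → Γ φ → Γ ψ

record IsPrimeLTheory (Γ : FormulaSet) : Set where
  field
    isLTheory : IsLTheory Γ
    consistent : ¬ Γ ⊥'
    prime : ∀ φ ψ → Γ (φ ∨' ψ) ⇔ (Γ φ ⊎ Γ ψ)

record NModel (ℓ : Level) : Set (lsuc ℓ) where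
  field
    World : Set ℓ
    _≤_   : World → World → Set ℓ
    N     : World → (World → Set ℓ) → Set ℓ
    V     : ℕ → World → Set ℓ

module Forcing {ℓ : Level} (M : NModel ℓ) where
  open NModel M

  _⊩_ : World → Formula → Set ℓ
  w ⊩ var q   = V q w
  w ⊩ ⊥'      = Lift ℓ Empty
  w ⊩ (φ ∧' ψ) = (w ⊩ φ) × (w ⊩ ψ)
  w ⊩ (φ ∨' ψ) = (w ⊩ φ) ⊎ (w ⊩ ψ)
  w ⊩ (φ ⇒ ψ) = ∀ v → w ≤ v → (¬ (v ⊩ φ)) ⊎ (v ⊩ ψ)
  w ⊩ □ φ     = (w ⊩ φ) × N w (λ z → z ⊩ φ)

CW : Set₁
CW = Σ FormulaSet IsPrimeLTheory

_∈w_ : Formula → CW → Set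
φ ∈w (Γ , _) = Γ φ

canonicalModel : NModel (lsuc 0ℓ)
canonicalModel = record
  { World = CW
  ; _≤_   = λ w v → Lift (lsuc 0ℓ) (∀ φ → φ ∈w w → φ ∈w v)
  ; N     = λ w X → Σ Formula (λ φ → (□ φ ∈w w) × (∀ z → X z ⇔ (φ ∈w z)))
  ; V     = λ q w → Lift (lsuc 0ℓ) (var q ∈w w)
  }

open Forcing canonicalModel public using () renaming (_⊩_ to _⊩ᶜ_)

-- Every step of the induction is a
-- closure property of prime theories except two, and both rest on the
-- Lindenbaum lemma (obtained classically, by an ω-chain that decides
-- every formula in turn): a theory not containing φ ⇒ ψ has a prime
-- extension containing φ but not ψ, and formulas belonging to the same
-- prime theories are L-provably equivalent. The latter is what lets the
-- neighbourhood {z ∣ z ⊩ φ}, known only to be some {z ∣ χ ∈ z} with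
-- □χ ∈ w, be traded for □φ ∈ w via the rule E.
module Submission where

open import Defs
open import Level using (Level; 0ℓ; lift; lower)
open import Axiom.ExcludedMiddle using (ExcludedMiddle)
open import Function using (_∘_)
open import Function.Bundles using (_⇔_; mk⇔; Equivalence)
open import Function.Construct.Symmetry using (⇔-sym)
open import Function.Construct.Composition using () renaming (equivalence to ⇔-trans)
open import Data.Nat using (ℕ; zero; suc; _⊔_; _≤′_; ≤′-refl; ≤′-step)
open import Data.Nat.Properties using (m≤m⊔n; m≤n⊔m; ≤⇒≤′)
open import Data.Empty using () renaming (⊥ to Empty; ⊥-elim to ⊥-elim)
open import Data.Product using (Σ; ∃; _×_; _,_; proj₁)
open import Data.Product.Function.NonDependent.Propositional using (_×-⇔_)
open import Data.Sum using (_⊎_; inj₁; inj₂; [_,_]′)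
open import Data.Sum.Function.Propositional using (_⊎-⇔_)
open import Relation.Nullary using (¬_; yes; no)
open import Relation.Binary.PropositionalEquality using (_≡_; refl)
open import Data.List using (List; []; _∷_; map; concat; cartesianProductWith)
open import Data.List.Membership.Propositional using (_∈_)
open import Data.List.Membership.Propositional.Properties
  using (∈-map⁺; ∈-concat⁺′; ∈-cartesianProductWith⁺)
open import Data.List.Relation.Unary.Any using (here; there)

variable
  φ ψ χ : Formula
  Γ Δ : FormulaSet
  m n : ℕ

infix 4 _⊆_
infixl 5 _,,_

_⊆_ : FormulaSet → FormulaSet → Set
Γ ⊆ Δ = ∀ φ → Γ φ → Δ φ

_,,_ : FormulaSet → Formula → FormulaSet
(Γ ,, φ) χ = Γ χ ⊎ χ ≡ φ

∅ : FormulaSet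
∅ _ = Empty

,,-mono : Γ ⊆ Δ → Γ ,, φ ⊆ Δ ,, φ
,,-mono Γ⊆Δ χ (inj₁ χ∈Γ) = inj₁ (Γ⊆Δ χ χ∈Γ)
,,-mono Γ⊆Δ χ (inj₂ χ≡φ) = inj₂ χ≡φ

Ascending : (ℕ → FormulaSet) → Set
Ascending S = ∀ n → S n ⊆ S (suc n)

⋃ : (ℕ → FormulaSet) → FormulaSet
⋃ S φ = ∃ λ n → S n φ

module _ {S : ℕ → FormulaSet} (asc : Ascending S) where

  ascending-≤′ : m ≤′ n → S m ⊆ S n
  ascending-≤′ ≤′-refl φ x = x
  ascending-≤′ (≤′-step m≤′n) φ x = asc _ φ (ascending-≤′ m≤′n φ x)

  ⋃-pair : ⋃ S φ → ⋃ S ψ → ∃ λ n → S n φ × S n ψ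
  ⋃-pair (m , x) (n , y) =
    m ⊔ n , ascending-≤′ (≤⇒≤′ (m≤m⊔n m n)) _ x , ascending-≤′ (≤⇒≤′ (m≤n⊔m m n)) _ y

infix 3.5 _⊢_
infixl 5 _·_

data _⊢_ (Γ : FormulaSet) : Formula → Set where
  hyp : Γ φ → Γ ⊢ φ
  thm : L⊢ φ → Γ ⊢ φ
  _·_ : Γ ⊢ φ ⇒ ψ → Γ ⊢ φ → Γ ⊢ ψ

⊢-mono : Γ ⊆ Δ → Γ ⊢ φ → Δ ⊢ φ
⊢-mono Γ⊆Δ (hyp x) = hyp (Γ⊆Δ _ x)
⊢-mono Γ⊆Δ (thm t) = thm t
⊢-mono Γ⊆Δ (d · e) = ⊢-mono Γ⊆Δ d · ⊢-mono Γ⊆Δ e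

L⊢-id : ∀ φ → L⊢ (φ ⇒ φ)
L⊢-id φ = mp (mp (ax-S φ (φ ⇒ φ) φ) (ax-K φ (φ ⇒ φ))) (ax-K φ φ)

deduction : Γ ,, φ ⊢ ψ → Γ ⊢ φ ⇒ ψ
deduction {φ = φ} {ψ} (hyp (inj₁ x)) = thm (ax-K ψ φ) · hyp x
deduction {φ = φ} (hyp (inj₂ refl)) = thm (L⊢-id φ)
deduction {φ = φ} {ψ} (thm t) = thm (ax-K ψ φ) · thm t
deduction {φ = φ} {ψ} (_·_ {χ} d e) = thm (ax-S φ χ ψ) · deduction d · deduction e

∅⊢⇒L⊢ : ∅ ⊢ φ → L⊢ φ
∅⊢⇒L⊢ (thm t) = t
∅⊢⇒L⊢ (d · e) = mp (∅⊢⇒L⊢ d) (∅⊢⇒L⊢ e)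

⊢-compact : {S : ℕ → FormulaSet} → Ascending S → ⋃ S ⊢ φ → ∃ λ n → S n ⊢ φ
⊢-compact asc (hyp (n , x)) = n , hyp x
⊢-compact asc (thm t) = 0 , thm t
⊢-compact {S = S} asc (d · e)
  with ⋃-pair {λ n → S n ⊢_} (λ n _ → ⊢-mono (asc n)) (⊢-compact asc d) (⊢-compact asc e)
... | n , d′ , e′ = n , d′ · e′

module _ (T : IsLTheory Γ) where
  open IsLTheory T

  theory-closed : Γ ⊢ φ → Γ φ
  theory-closed (hyp x) = x
  theory-closed (thm t) = theorems t
  theory-closed (d · e) = mp-closed (theory-closed d) (theory-closed e)

  theory-∧ : Γ (φ ∧' ψ) ⇔ (Γ φ × Γ ψ)
  theory-∧ {φ} {ψ} = mk⇔
    (λ x → theory-closed (thm (ax-∧E₁ φ ψ) · hyp x) , theory-closed (thm (ax-∧E₂ φ ψ) · hyp x))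
    (λ (x , y) → theory-closed (thm (ax-∧I φ ψ) · hyp x · hyp y))

  theory-□ : Γ (□ φ) → Γ φ
  theory-□ {φ} x = theory-closed (thm (ax-T φ) · hyp x)

∈w-closed : (w : CW) → proj₁ w ⊢ φ → φ ∈w w
∈w-closed (_ , P) = theory-closed (IsPrimeLTheory.isLTheory P)

formulas : ℕ → List Formula
formulasByShape : ℕ → List (List Formula)

formulas zero = []
formulas (suc n) = concat (formulasByShape n)

formulasByShape n =
  F ∷ (var n ∷ ⊥' ∷ []) ∷ map □ F
  ∷ cartesianProductWith _∧'_ F F ∷ cartesianProductWith _∨'_ F F
  ∷ cartesianProductWith _⇒_ F F ∷ []
  where F = formulas n

∈-formulasByShape : ∀ {F} → φ ∈ F → F ∈ formulasByShape n → φ ∈ formulas (suc n)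
∈-formulasByShape {n = n} = ∈-concat⁺′ {xss = formulasByShape n}

formulas-ascending : Ascending (λ n φ → φ ∈ formulas n)
formulas-ascending n φ p = ∈-formulasByShape p (here refl)

formulas-complete : ∀ φ → ∃ λ n → φ ∈ formulas n
formulas-complete (var k) = suc k , ∈-formulasByShape (here refl) (there (here refl))
formulas-complete ⊥' = 1 , ∈-formulasByShape {n = 0} (there (here refl)) (there (here refl))
formulas-complete (□ φ) with formulas-complete φ
... | n , p = suc n , ∈-formulasByShape (∈-map⁺ □ p) (there (there (here refl)))
formulas-complete (φ ∧' ψ) with ⋃-pair formulas-ascending (formulas-complete φ) (formulas-complete ψ)
... | n , p , q = suc n , ∈-formulasByShape (∈-cartesianProductWith⁺ _∧'_ p q) (there (there (there (here refl))))
formulas-complete (φ ∨' ψ) with ⋃-pair formulas-ascending (formulas-complete φ) (formulas-complete ψ)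
... | n , p , q = suc n , ∈-formulasByShape (∈-cartesianProductWith⁺ _∨'_ p q) (there (there (there (there (here refl)))))
formulas-complete (φ ⇒ ψ) with ⋃-pair formulas-ascending (formulas-complete φ) (formulas-complete ψ)
... | n , p , q = suc n , ∈-formulasByShape (∈-cartesianProductWith⁺ _⇒_ p q) (there (there (there (there (there (here refl))))))

module Avoiding (ψ : Formula) where

  Decides : FormulaSet → Formula → Set
  Decides Δ χ = Δ χ ⊎ Δ ,, χ ⊢ ψ

  decides-mono : Γ ⊆ Δ → Decides Γ χ → Decides Δ χ
  decides-mono Γ⊆Δ (inj₁ x) = inj₁ (Γ⊆Δ _ x)
  decides-mono Γ⊆Δ (inj₂ d) = inj₂ (⊢-mono (,,-mono Γ⊆Δ) d)

  module _ (Δ⊬ψ : ¬ Δ ⊢ ψ) (decides : ∀ χ → Decides Δ χ) where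

    maximal-closed : Δ ⊢ χ → Δ χ
    maximal-closed {χ} d = [ (λ x → x) , (λ e → ⊥-elim (Δ⊬ψ (deduction e · d))) ]′ (decides χ)

    maximal-prime : IsPrimeLTheory Δ
    maximal-prime = record
      { isLTheory = record
        { theorems = maximal-closed ∘ thm
        ; mp-closed = λ x y → maximal-closed (hyp x · hyp y) }
      ; consistent = λ x → Δ⊬ψ (thm (ax-⊥E ψ) · hyp x)
      ; prime = λ φ₁ φ₂ → mk⇔ (split φ₁ φ₂ (decides φ₁) (decides φ₂))
          [ (λ x → maximal-closed (thm (ax-∨I₁ φ₁ φ₂) · hyp x))
          , (λ y → maximal-closed (thm (ax-∨I₂ φ₁ φ₂) · hyp y)) ]′ }
      where
      split : ∀ φ₁ φ₂ → Decides Δ φ₁ → Decides Δ φ₂ → Δ (φ₁ ∨' φ₂) → Δ φ₁ ⊎ Δ φ₂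
      split φ₁ φ₂ (inj₁ x) _ _ = inj₁ x
      split φ₁ φ₂ _ (inj₁ y) _ = inj₂ y
      split φ₁ φ₂ (inj₂ d₁) (inj₂ d₂) z =
        ⊥-elim (Δ⊬ψ (thm (ax-∨E φ₁ φ₂ ψ) · deduction d₁ · deduction d₂ · hyp z))

  insert : Formula → FormulaSet → FormulaSet
  insert χ Δ φ = Δ φ ⊎ (φ ≡ χ × ¬ Δ ,, χ ⊢ ψ)

  insert-⊇ : Δ ⊆ insert χ Δ
  insert-⊇ _ = inj₁

  insert-avoids : ¬ Δ ⊢ ψ → ¬ insert χ Δ ⊢ ψ
  insert-avoids {Δ} {χ} Δ⊬ψ d = Δ⊬ψ (⊢-mono insert⊆Δ d)
    where
    insert⊆Δ,,χ : insert χ Δ ⊆ Δ ,, χ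
    insert⊆Δ,,χ _ (inj₁ x) = inj₁ x
    insert⊆Δ,,χ _ (inj₂ (φ≡χ , _)) = inj₂ φ≡χ
    insert⊆Δ : insert χ Δ ⊆ Δ
    insert⊆Δ _ (inj₁ x) = x
    insert⊆Δ _ (inj₂ (_ , Δ,,χ⊬ψ)) = ⊥-elim (Δ,,χ⊬ψ (⊢-mono insert⊆Δ,,χ d))

  insert-decides : ExcludedMiddle 0ℓ → Decides (insert χ Δ) χ
  insert-decides {χ} {Δ} em with em {Δ ,, χ ⊢ ψ}
  ... | yes d = inj₂ (⊢-mono (,,-mono insert-⊇) d)
  ... | no Δ,,χ⊬ψ = inj₁ (inj₂ (refl , Δ,,χ⊬ψ))

  insertAll : List Formula → FormulaSet → FormulaSet
  insertAll [] Δ = Δ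
  insertAll (χ ∷ χs) Δ = insertAll χs (insert χ Δ)

  insertAll-⊇ : ∀ χs → Δ ⊆ insertAll χs Δ
  insertAll-⊇ [] _ x = x
  insertAll-⊇ (χ ∷ χs) φ x = insertAll-⊇ χs φ (insert-⊇ φ x)

  insertAll-avoids : ∀ χs → ¬ Δ ⊢ ψ → ¬ insertAll χs Δ ⊢ ψ
  insertAll-avoids [] Δ⊬ψ = Δ⊬ψ
  insertAll-avoids (χ ∷ χs) Δ⊬ψ = insertAll-avoids χs (insert-avoids Δ⊬ψ)

  insertAll-decides : ExcludedMiddle 0ℓ → ∀ χs → χ ∈ χs → Decides (insertAll χs Δ) χ
  insertAll-decides em (χ ∷ χs) (here refl) = decides-mono (insertAll-⊇ χs) (insert-decides em)
  insertAll-decides em (_ ∷ χs) (there p) = insertAll-decides em χs p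

  module Chain (em : ExcludedMiddle 0ℓ) (Γ : FormulaSet) (Γ⊬ψ : ¬ Γ ⊢ ψ) where

    stage : ℕ → FormulaSet
    stage zero = Γ
    stage (suc n) = insertAll (formulas n) (stage n)

    stage-ascending : Ascending stage
    stage-ascending n = insertAll-⊇ (formulas n)

    stage-avoids : ∀ n → ¬ stage n ⊢ ψ
    stage-avoids zero = Γ⊬ψ
    stage-avoids (suc n) = insertAll-avoids (formulas n) (stage-avoids n)

    limit-avoids : ¬ ⋃ stage ⊢ ψ
    limit-avoids d with ⊢-compact stage-ascending d
    ... | n , d′ = stage-avoids n d′

    limit-decides : ∀ χ → Decides (⋃ stage) χ
    limit-decides χ with formulas-complete χ
    ... | n , p = decides-mono (λ _ x → suc n , x) (insertAll-decides em (formulas n) p)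

lindenbaum : ExcludedMiddle 0ℓ → ¬ Γ ⊢ ψ → Σ CW λ v → Γ ⊆ proj₁ v × ¬ ψ ∈w v
lindenbaum {Γ} {ψ} em Γ⊬ψ =
  (⋃ stage , maximal-prime limit-avoids limit-decides) , (λ _ x → 0 , x) , limit-avoids ∘ hyp
  where open Avoiding ψ
        open Chain em Γ Γ⊬ψ

separation : ExcludedMiddle 0ℓ → ¬ Γ ⊢ φ ⇒ ψ →
  Σ CW λ v → Γ ⊆ proj₁ v × φ ∈w v × ¬ ψ ∈w v
separation {φ = φ} em Γ⊬φ⇒ψ with lindenbaum em (Γ⊬φ⇒ψ ∘ deduction)
... | v , Γ,,φ⊆v , ψ∉v = v , (λ χ → Γ,,φ⊆v χ ∘ inj₁) , Γ,,φ⊆v φ (inj₂ refl) , ψ∉v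

module _ (em : ExcludedMiddle 0ℓ) where

  ∈w-⇒ : (w : CW) → (φ ⇒ ψ) ∈w w ⇔ (∀ v → proj₁ w ⊆ proj₁ v → φ ∈w v → ψ ∈w v)
  ∈w-⇒ {φ} {ψ} w = mk⇔ (λ x v w⊆v y → ∈w-closed v (hyp (w⊆v _ x) · hyp y)) from
    where
    from : (∀ v → proj₁ w ⊆ proj₁ v → φ ∈w v → ψ ∈w v) → (φ ⇒ ψ) ∈w w
    from H with em {(φ ⇒ ψ) ∈w w}
    ... | yes x = x
    ... | no φ⇒ψ∉w with separation em (φ⇒ψ∉w ∘ ∈w-closed w)
    ...   | v , w⊆v , φ∈v , ψ∉v = ⊥-elim (ψ∉v (H v w⊆v φ∈v))

  ∈w-valid-⇒ : (∀ z → φ ∈w z → ψ ∈w z) → L⊢ (φ ⇒ ψ)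
  ∈w-valid-⇒ {φ} {ψ} H with em {L⊢ (φ ⇒ ψ)}
  ... | yes t = t
  ... | no ⊬φ⇒ψ with separation {Γ = ∅} em (⊬φ⇒ψ ∘ ∅⊢⇒L⊢)
  ...   | v , _ , φ∈v , ψ∉v = ⊥-elim (ψ∉v (H v φ∈v))

  ∈w-□-cong : (∀ z → φ ∈w z ⇔ ψ ∈w z) → (w : CW) → □ φ ∈w w → □ ψ ∈w w
  ∈w-□-cong {φ} {ψ} φ≈ψ w x = ∈w-closed w (thm (ax-∧E₁ (□ φ ⇒ □ ψ) (□ ψ ⇒ □ φ)) · thm □φ⇔□ψ · hyp x)
    where
    □φ⇔□ψ : L⊢ (□ φ ⇔' □ ψ)
    □φ⇔□ψ = rule-E (mp (mp (ax-∧I (φ ⇒ ψ) (ψ ⇒ φ))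
      (∈w-valid-⇒ (Equivalence.to ∘ φ≈ψ)))
      (∈w-valid-⇒ (Equivalence.from ∘ φ≈ψ)))

  truth : ∀ φ (w : CW) → (w ⊩ᶜ φ) ⇔ (φ ∈w w)
  truth (var q) w = mk⇔ lower lift
  truth ⊥' (Γ , P) = mk⇔ (λ ()) (⊥-elim ∘ IsPrimeLTheory.consistent P)
  truth (φ ∧' ψ) (Γ , P) =
    ⇔-trans (truth φ (Γ , P) ×-⇔ truth ψ (Γ , P)) (⇔-sym (theory-∧ (IsPrimeLTheory.isLTheory P)))
  truth (φ ∨' ψ) (Γ , P) =
    ⇔-trans (truth φ (Γ , P) ⊎-⇔ truth ψ (Γ , P)) (⇔-sym (IsPrimeLTheory.prime P φ ψ))
  truth (φ ⇒ ψ) w = ⇔-trans (mk⇔ to from) (⇔-sym (∈w-⇒ w))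
    where
    to : w ⊩ᶜ (φ ⇒ ψ) → ∀ v → proj₁ w ⊆ proj₁ v → φ ∈w v → ψ ∈w v
    to H v w⊆v φ∈v =
      [ (λ v⊮φ → ⊥-elim (v⊮φ (Equivalence.from (truth φ v) φ∈v))) , Equivalence.to (truth ψ v) ]′
        (H v (lift w⊆v))
    from : (∀ v → proj₁ w ⊆ proj₁ v → φ ∈w v → ψ ∈w v) → w ⊩ᶜ (φ ⇒ ψ)
    from H v (lift w⊆v) with em {φ ∈w v}
    ... | yes φ∈v = inj₂ (Equivalence.from (truth ψ v) (H v w⊆v φ∈v))
    ... | no φ∉v = inj₁ (φ∉v ∘ Equivalence.to (truth φ v))
  truth (□ φ) (Γ , P) = mk⇔ to from
    where
    to : (Γ , P) ⊩ᶜ □ φ → Γ (□ φ)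
    to (_ , χ , □χ∈w , ⊩φ≈χ) =
      ∈w-□-cong (λ z → ⇔-trans (⇔-sym (⊩φ≈χ z)) (truth φ z)) (Γ , P) □χ∈w
    from : Γ (□ φ) → (Γ , P) ⊩ᶜ □ φ
    from □φ∈w =
      Equivalence.from (truth φ (Γ , P)) (theory-□ (IsPrimeLTheory.isLTheory P) □φ∈w) ,
      φ , □φ∈w , (λ z → truth φ z)

mainTheorem7 : ({ℓ : Level} → ExcludedMiddle ℓ) →
    ∀ (φ : Formula) (w : CW) → (w ⊩ᶜ φ) ⇔ (φ ∈w w)
mainTheorem7 em = truth em
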